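{- Let $L,m$ be integers with $1<m\leq 2^L$, and let $l=\lceil\log_2 m\rceil$. Let $(\beta_1,\dots,\beta_{2^L})$ be a Cantor basis of ${\rm GF}(2^{2^L})$ over ${\rm GF}(2)$, with associated subspaces $W_i$ and enumeration $\varpi_0,\varpi_1,\dots$ as in the context. Let $a\in W_{2^L}\setminus W_m$ and $b=a^{2^{2^{l-1}}}-a$. Let $f$ be a polynomial over ${\rm GF}(2^{2^L})$ of degree $<2^m$. Let $0\leq i<2^{2^{l-1}}$ and $0\leq j<2^{m-2^{l-1}}$, put $a_j=a+\varpi_{j2^{2^{l-1}}}$, and let $r_j$ be the remainder of $f$ modulo $x^{2^{2^{l-1}}}-x-(b+\varpi_j)$. Then $$f\big(a+\varpi_{i+j2^{2^{l-1}}}\big)=r_j(a_j+\varpi_i).$$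
   Context: A Cantor basis of ${\rm GF}(2^{2^L})$ over ${\rm GF}(2)$ is a basis $(\beta_1,\dots,\beta_{2^L})$ of ${\rm GF}(2^{2^L})$ as a ${\rm GF}(2)$-vector space such that $\beta_1=1$ and $\beta_i^2-\beta_i=\beta_{i-1}$ for all $1<i\le 2^L$. For $1\le i\le 2^L$, $W_i=\sum_{t=1}^i{\rm GF}(2)\beta_t$ (so $W_{2^L}={\rm GF}(2^{2^L})$). For an integer $0\le u<2^{2^L}$ with binary expansion $u=\sum_{t\ge 0}u_t2^t$, $u_t\in\{0,1\}$, one sets $\varpi_u=\sum_{t\ge0}u_t\beta_{t+1}$; this enumerates the elements of ${\rm GF}(2^{2^L})$ in increasing order for the order induced by the basis. -}

module Defs where

open import Level using (Level)
open import Data.Bool using (Bool; true; false; if_then_else_)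
open import Data.Nat as ℕ using (ℕ; zero; suc; _≤_; _<_; _%_; _/_; _≡ᵇ_)
open import Data.List using (List; []; _∷_; map; foldr; replicate; _++_)
open import Data.Product using (Σ; _×_; ∃)
open import Relation.Nullary using (¬_)
open import Relation.Binary.PropositionalEquality using (_≡_)
open import Algebra.Bundles using (CommutativeRing)

testBit : ℕ → ℕ → Bool
testBit zero    u = u % 2 ≡ᵇ 1
testBit (suc t) u = testBit t (u / 2)

module Field {c ℓ : Level} (R : CommutativeRing c ℓ) where
  open CommutativeRing R

  pow : Carrier → ℕ → Carrier
  pow x zero    = 1#
  pow x (suc n) = x * pow x n

  Σ< : ℕ → (ℕ → Carrier) → Carrier
  Σ< zero    f = 0#
  Σ< (suc n) f = Σ< n f + f n

  -- GF(2)-scalar (a Bool) times an element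
  _·_ : Bool → Carrier → Carrier
  true  · x = x
  false · x = 0#

  IsField : Set (c Level.⊔ ℓ)
  IsField = (¬ (1# ≈ 0#)) × (∀ x → ¬ (x ≈ 0#) → ∃ λ y → x * y ≈ 1#)

  -- β : ℕ → Carrier, zero-indexed: β t stands for β_{t+1} of the paper.
  -- (β 0 , … , β (n-1)) is a basis of the carrier as a GF(2)-vector space.
  IsGF2Basis : ℕ → (ℕ → Carrier) → Set (c Level.⊔ ℓ)
  IsGF2Basis n β =
    (∀ (e : ℕ → Bool) → Σ< n (λ t → e t · β t) ≈ 0# → ∀ t → t < n → e t ≡ false)
    × (∀ x → ∃ λ (e : ℕ → Bool) → x ≈ Σ< n (λ t → e t · β t))

  -- Cantor basis of GF(2^(2^L)) over GF(2) (assumes characteristic 2)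
  IsCantorBasis : ℕ → (ℕ → Carrier) → Set (c Level.⊔ ℓ)
  IsCantorBasis L β =
    IsGF2Basis (2 ℕ.^ L) β
    × β 0 ≈ 1#
    × (∀ t → suc t < 2 ℕ.^ L → pow (β (suc t)) 2 - β (suc t) ≈ β t)

  InW : (ℕ → Carrier) → ℕ → Carrier → Set ℓ
  InW β i x = ∃ λ (e : ℕ → Bool) → x ≈ Σ< i (λ t → e t · β t)

  varpi : ℕ → (ℕ → Carrier) → ℕ → Carrier
  varpi L β u = Σ< (2 ℕ.^ L) (λ t → testBit t u · β t)

  -- Polynomials: coefficient lists, constant term first.
  Poly : Set c
  Poly = List Carrier

  _+ₚ_ : Poly → Poly → Poly
  []       +ₚ q        = q
  (a ∷ p)  +ₚ []       = a ∷ p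
  (a ∷ p)  +ₚ (b ∷ q)  = (a + b) ∷ (p +ₚ q)

  _*ₚ_ : Poly → Poly → Poly
  []      *ₚ q = []
  (a ∷ p) *ₚ q = map (a *_) q +ₚ (0# ∷ (p *ₚ q))

  coeff : Poly → ℕ → Carrier
  coeff []      k       = 0#
  coeff (a ∷ p) zero    = a
  coeff (a ∷ p) (suc k) = coeff p k

  _≋_ : Poly → Poly → Set ℓ
  p ≋ q = ∀ k → coeff p k ≈ coeff q k

  eval : Poly → Carrier → Carrier
  eval p x = foldr (λ a acc → a + x * acc) 0# p

  DegLt : Poly → ℕ → Set ℓ
  DegLt p d = ∀ k → d ≤ k → coeff p k ≈ 0#

  Xpow : ℕ → Poly
  Xpow N = replicate N 0# ++ (1# ∷ [])

  trinom : ℕ → Carrier → Poly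
  trinom N e = Xpow N +ₚ ((- e) ∷ (- 1#) ∷ [])

  IsRemainder : Poly → Poly → ℕ → Poly → Set (c Level.⊔ ℓ)
  IsRemainder f g N r = DegLt r N × (∃ λ q → f ≋ ((q *ₚ g) +ₚ r))

module Submission where

-- In characteristic 2 the Artin–Schreier map ℘ x = x² − x is additive, and for
-- k = 2^s its k-th iterate is x ↦ x^(2^k) − x. On a Cantor basis ℘ sends
-- β_{t+1} to β_t and β_1 = 1 to 0, so ℘^k kills ϖ_i for i < 2^k and sends
-- ϖ_{j 2^k} to ϖ_j. Hence x = a + ϖ_{i + j 2^k} satisfies
-- x^(2^k) − x = (a^(2^k) − a) + ϖ_j: it is a root of the trinomial, so f and its
-- remainder r agree at x, and x = a_j + ϖ_i.

open import Defs
open import Level using (Level; _⊔_)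
open import Data.Bool using (true; false; _∨_; _∧_)
open import Data.List using ([]; _∷_; map)
open import Data.Nat as ℕ using (ℕ; zero; suc; _<_; _≤_; _^_; _∸_; _<?_; s≤s)
import Data.Nat.Properties as ℕₚ
open import Data.Nat.Logarithm using (⌈log₂_⌉; ⌈log₂⌉-mono-≤; ⌈log₂2^n⌉≡n)
open import Data.Product using (_,_)
open import Data.Sum using (inj₁; inj₂)
open import Relation.Nullary using (¬_; yes; no)
open import Relation.Binary.PropositionalEquality as ≡ using (_≡_)
open import Algebra.Bundles using (CommutativeRing)
open import Algebra.Morphism.Structures using (module MonoidMorphisms)
import Algebra.Morphism.Construct.Composition as Composition
import Algebra.Morphism.Construct.Identity as Identity

module BinaryDigits where

  open import Data.Bool.Properties using (∨-identityʳ; ∧-zeroʳ)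
  open import Data.Nat using (_+_; _*_; _/_; _%_; _≡ᵇ_)
  open import Data.Nat.DivMod using (m<n*o⇒m/o<n; +-distrib-/-∣ʳ; m*n/n≡m; [m+kn]%n≡m%n)
  open import Data.Nat.Divisibility using (n∣m*n)
  open import Data.Nat.Properties using (*-comm; *-assoc; *-identityʳ; m^n>0; ≮⇒≥; m+[n∸m]≡n)
  open import Relation.Binary.PropositionalEquality

  testBit-0 : ∀ t → testBit t 0 ≡ false
  testBit-0 zero    = refl
  testBit-0 (suc t) = testBit-0 t

  /2-<2^ : ∀ {x} n → x < 2 ^ suc n → x / 2 < 2 ^ n
  /2-<2^ {x} n x<2^1+n = m<n*o⇒m/o<n (subst (x <_) (*-comm 2 (2 ^ n)) x<2^1+n)

  *2^suc≡*2^*2 : ∀ j k → j * 2 ^ suc k ≡ (j * 2 ^ k) * 2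
  *2^suc≡*2^*2 j k = trans (cong (j *_) (*-comm 2 (2 ^ k))) (sym (*-assoc j (2 ^ k) 2))

  +-*2^suc-/2 : ∀ i j k → (i + j * 2 ^ suc k) / 2 ≡ i / 2 + j * 2 ^ k
  +-*2^suc-/2 i j k rewrite *2^suc≡*2^*2 j k =
    trans (+-distrib-/-∣ʳ i (n∣m*n (j * 2 ^ k))) (cong (i / 2 +_) (m*n/n≡m (j * 2 ^ k) 2))

  +-*2^suc-%2 : ∀ i j k → (i + j * 2 ^ suc k) % 2 ≡ i % 2
  +-*2^suc-%2 i j k rewrite *2^suc≡*2^*2 j k = [m+kn]%n≡m%n i (j * 2 ^ k) 2

  testBit-high : ∀ {x} n t → x < 2 ^ n → n ≤ t → testBit t x ≡ false
  testBit-high {zero}  zero    t       _          _       = testBit-0 t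
  testBit-high {suc x} zero    t       (s≤s ())   _
  testBit-high         (suc n) (suc t) x<2^1+n (s≤s n≤t) = testBit-high n t (/2-<2^ n x<2^1+n) n≤t

  testBit-low : ∀ {i} j k t → i < 2 ^ k → t < k → testBit t (i + j * 2 ^ k) ≡ testBit t i
  testBit-low {i} j (suc k) zero    _       _         = cong (_≡ᵇ 1) (+-*2^suc-%2 i j k)
  testBit-low {i} j (suc k) (suc t) i<2^1+k (s≤s t<k) =
    trans (cong (testBit t) (+-*2^suc-/2 i j k)) (testBit-low j k t (/2-<2^ k i<2^1+k) t<k)

  testBit-shift : ∀ {i} j k u → i < 2 ^ k → testBit (k + u) (i + j * 2 ^ k) ≡ testBit u j
  testBit-shift {zero}  j zero    u _        = cong (testBit u) (*-identityʳ j)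
  testBit-shift {suc i} j zero    u (s≤s ())
  testBit-shift {i}     j (suc k) u i<2^1+k  =
    trans (cong (testBit (k + u)) (+-*2^suc-/2 i j k)) (testBit-shift j k u (/2-<2^ k i<2^1+k))

  testBit-*2^ : ∀ j k t → t < k → testBit t (j * 2 ^ k) ≡ false
  testBit-*2^ j k t t<k = trans (testBit-low j k t (m^n>0 2 k) t<k) (testBit-0 t)

  -- Since i < 2^k, the binary digits of i and of j * 2^k occupy disjoint positions.
  testBit-+-*2^ : ∀ {i} j k t → i < 2 ^ k →
                  testBit t (i + j * 2 ^ k) ≡ testBit t i ∨ testBit t (j * 2 ^ k)
  testBit-+-*2^ {i} j k t i<2^k with t <? k
  ... | yes t<k = begin
    testBit t (i + j * 2 ^ k)            ≡⟨ testBit-low j k t i<2^k t<k ⟩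
    testBit t i                          ≡⟨ ∨-identityʳ (testBit t i) ⟨
    testBit t i ∨ false                  ≡⟨ cong (testBit t i ∨_) (testBit-*2^ j k t t<k) ⟨
    testBit t i ∨ testBit t (j * 2 ^ k)  ∎
    where open ≡-Reasoning
  ... | no t≮k = begin
    testBit t (i + j * 2 ^ k)            ≡⟨ cong (λ s → testBit s (i + j * 2 ^ k)) t≡k+u ⟩
    testBit (k + u) (i + j * 2 ^ k)      ≡⟨ testBit-shift j k u i<2^k ⟩
    testBit u j                          ≡⟨ testBit-shift j k u (m^n>0 2 k) ⟨
    testBit (k + u) (j * 2 ^ k)          ≡⟨ cong (λ s → testBit s (j * 2 ^ k)) t≡k+u ⟨
    testBit t (j * 2 ^ k)                ≡⟨ cong (_∨ testBit t (j * 2 ^ k)) (testBit-high k t i<2^k (≮⇒≥ t≮k)) ⟨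
    testBit t i ∨ testBit t (j * 2 ^ k)  ∎
    where
    open ≡-Reasoning
    u = t ∸ k
    t≡k+u : t ≡ k + u
    t≡k+u = sym (m+[n∸m]≡n (≮⇒≥ t≮k))

  testBit-∧-*2^ : ∀ {i} j k t → i < 2 ^ k → testBit t i ∧ testBit t (j * 2 ^ k) ≡ false
  testBit-∧-*2^ {i} j k t i<2^k with t <? k
  ... | yes t<k = trans (cong (testBit t i ∧_) (testBit-*2^ j k t t<k)) (∧-zeroʳ _)
  ... | no t≮k  = cong (_∧ testBit t (j * 2 ^ k)) (testBit-high k t i<2^k (≮⇒≥ t≮k))

open BinaryDigits

module _ {c ℓ : Level} (R : CommutativeRing c ℓ) where
  open CommutativeRing R
  open Field R
  open import Relation.Binary.Reasoning.Setoid setoid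
  open import Algebra.Properties.CommutativeSemigroup +-commutativeSemigroup using (interchange)
  open import Algebra.Properties.Ring ring using (-‿distribʳ-*)
  open import Algebra.Properties.AbelianGroup +-abelianGroup using (⁻¹-∙-comm; inverseʳ-unique)
  import Algebra.Properties.Semiring.Exp semiring as Exp
  open import Function.Endo.Propositional Carrier using () renaming (_^_ to _^ᶠ_; ^-homo to ^ᶠ-homo)
  open MonoidMorphisms +-rawMonoid +-rawMonoid using (IsMonoidHomomorphism)

  Σ<-cong : ∀ n {f g} → (∀ t → t < n → f t ≈ g t) → Σ< n f ≈ Σ< n g
  Σ<-cong zero    f≈g = refl
  Σ<-cong (suc n) f≈g = +-cong (Σ<-cong n (λ t t<n → f≈g t (ℕₚ.m<n⇒m<1+n t<n))) (f≈g n (ℕₚ.n<1+n n))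

  Σ<-zero : ∀ n {f} → (∀ t → t < n → f t ≈ 0#) → Σ< n f ≈ 0#
  Σ<-zero zero    f≈0 = refl
  Σ<-zero (suc n) f≈0 =
    trans (+-cong (Σ<-zero n (λ t t<n → f≈0 t (ℕₚ.m<n⇒m<1+n t<n))) (f≈0 n (ℕₚ.n<1+n n))) (+-identityʳ 0#)

  Σ<-distrib-+ : ∀ n f g → Σ< n (λ t → f t + g t) ≈ Σ< n f + Σ< n g
  Σ<-distrib-+ zero    f g = sym (+-identityʳ 0#)
  Σ<-distrib-+ (suc n) f g = trans (+-congʳ (Σ<-distrib-+ n f g)) (interchange _ _ _ _)

  Σ<-split : ∀ m n f → Σ< (m ℕ.+ n) f ≈ Σ< m f + Σ< n (λ u → f (m ℕ.+ u))
  Σ<-split m zero    f = trans (reflexive (≡.cong (λ k → Σ< k f) (ℕₚ.+-identityʳ m))) (sym (+-identityʳ _))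
  Σ<-split m (suc n) f = begin
    Σ< (m ℕ.+ suc n) f                                    ≡⟨ ≡.cong (λ k → Σ< k f) (ℕₚ.+-suc m n) ⟩
    Σ< (m ℕ.+ n) f + f (m ℕ.+ n)                          ≈⟨ +-congʳ (Σ<-split m n f) ⟩
    (Σ< m f + Σ< n (λ u → f (m ℕ.+ u))) + f (m ℕ.+ n)     ≈⟨ +-assoc _ _ _ ⟩
    Σ< m f + Σ< (suc n) (λ u → f (m ℕ.+ u))               ∎

  Σ<-drop-zero-prefix : ∀ m n f → (∀ t → t < m → f t ≈ 0#) → Σ< (m ℕ.+ n) f ≈ Σ< n (λ u → f (m ℕ.+ u))
  Σ<-drop-zero-prefix m n f f≈0 = trans (Σ<-split m n f) (trans (+-congʳ (Σ<-zero m f≈0)) (+-identityˡ _))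

  Σ<-drop-zero-suffix : ∀ m n f → (∀ u → u < n → f (m ℕ.+ u) ≈ 0#) → Σ< (m ℕ.+ n) f ≈ Σ< m f
  Σ<-drop-zero-suffix m n f f≈0 = trans (Σ<-split m n f) (trans (+-congˡ (Σ<-zero n f≈0)) (+-identityʳ _))

  ·-cong : ∀ b {x y} → x ≈ y → b · x ≈ b · y
  ·-cong true  x≈y = x≈y
  ·-cong false _   = refl

  ·-zeroʳ : ∀ b → b · 0# ≈ 0#
  ·-zeroʳ true  = refl
  ·-zeroʳ false = refl

  ∨-·-distrib : ∀ b b′ x → b ∧ b′ ≡ false → (b ∨ b′) · x ≈ b · x + b′ · x
  ∨-·-distrib true  false x _ = sym (+-identityʳ x)
  ∨-·-distrib false b′    x _ = sym (+-identityˡ (b′ · x))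

  pow≡^ : ∀ x n → pow x n ≡ x Exp.^ n
  pow≡^ x zero    = ≡.refl
  pow≡^ x (suc n) = ≡.cong (x *_) (pow≡^ x n)

  pow-+ : ∀ x m n → pow x (m ℕ.+ n) ≈ pow x m * pow x n
  pow-+ x m n rewrite pow≡^ x (m ℕ.+ n) | pow≡^ x m | pow≡^ x n = Exp.^-homo-* x m n

  IsAdditive : (Carrier → Carrier) → Set (c ⊔ ℓ)
  IsAdditive = IsMonoidHomomorphism

  id-isAdditive : IsAdditive (λ x → x)
  id-isAdditive = Identity.isMonoidHomomorphism +-rawMonoid refl

  module _ {f : Carrier → Carrier} (f-additive : IsAdditive f) where
    open IsMonoidHomomorphism f-additive

    ^ᶠ-isAdditive : ∀ n → IsAdditive (f ^ᶠ n)
    ^ᶠ-isAdditive zero    = id-isAdditive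
    ^ᶠ-isAdditive (suc n) = Composition.isMonoidHomomorphism trans (^ᶠ-isAdditive n) f-additive

    additive-Σ< : ∀ n g → f (Σ< n g) ≈ Σ< n (λ t → f (g t))
    additive-Σ< zero    g = ε-homo
    additive-Σ< (suc n) g = trans (homo _ _) (+-congʳ (additive-Σ< n g))

    additive-· : ∀ b x → f (b · x) ≈ b · f x
    additive-· true  x = refl
    additive-· false x = ε-homo

  -ᶠ-isAdditive : ∀ {f g} → IsAdditive f → IsAdditive g → IsAdditive (λ x → f x - g x)
  -ᶠ-isAdditive {f} {g} f-additive g-additive = record
    { isMagmaHomomorphism = record
      { isRelHomomorphism = record { cong = λ x≈y → +-cong (F.⟦⟧-cong x≈y) (-‿cong (G.⟦⟧-cong x≈y)) }
      ; homo = λ x y → begin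
          f (x + y) - g (x + y)            ≈⟨ +-cong (F.homo x y) (-‿cong (G.homo x y)) ⟩
          (f x + f y) - (g x + g y)        ≈⟨ +-congˡ (⁻¹-∙-comm (g x) (g y)) ⟨
          (f x + f y) + (- g x + - g y)    ≈⟨ interchange _ _ _ _ ⟩
          (f x - g x) + (f y - g y)        ∎
      }
    ; ε-homo = trans (+-cong F.ε-homo (-‿cong G.ε-homo)) (-‿inverseʳ 0#)
    }
    where module F = IsMonoidHomomorphism f-additive
          module G = IsMonoidHomomorphism g-additive

  eval-+ₚ : ∀ p q x → eval (p +ₚ q) x ≈ eval p x + eval q x
  eval-+ₚ []      q       x = sym (+-identityˡ _)
  eval-+ₚ (a ∷ p) []      x = sym (+-identityʳ _)
  eval-+ₚ (a ∷ p) (b ∷ q) x = begin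
    (a + b) + x * eval (p +ₚ q) x            ≈⟨ +-congˡ (*-congˡ (eval-+ₚ p q x)) ⟩
    (a + b) + x * (eval p x + eval q x)      ≈⟨ +-congˡ (distribˡ x _ _) ⟩
    (a + b) + (x * eval p x + x * eval q x)  ≈⟨ interchange _ _ _ _ ⟩
    (a + x * eval p x) + (b + x * eval q x)  ∎

  eval-map-* : ∀ a q x → eval (map (a *_) q) x ≈ a * eval q x
  eval-map-* a []      x = sym (zeroʳ a)
  eval-map-* a (b ∷ q) x = begin
    a * b + x * eval (map (a *_) q) x  ≈⟨ +-congˡ (*-congˡ (eval-map-* a q x)) ⟩
    a * b + x * (a * eval q x)         ≈⟨ +-congˡ (x∙yz≈y∙xz x a _) ⟩
    a * b + a * (x * eval q x)         ≈⟨ distribˡ a _ _ ⟨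
    a * (b + x * eval q x)             ∎
    where open import Algebra.Properties.CommutativeSemigroup *-commutativeSemigroup using (x∙yz≈y∙xz)

  eval-*ₚ : ∀ p q x → eval (p *ₚ q) x ≈ eval p x * eval q x
  eval-*ₚ []      q x = sym (zeroˡ _)
  eval-*ₚ (a ∷ p) q x = begin
    eval (map (a *_) q +ₚ (0# ∷ (p *ₚ q))) x            ≈⟨ eval-+ₚ (map (a *_) q) (0# ∷ (p *ₚ q)) x ⟩
    eval (map (a *_) q) x + (0# + x * eval (p *ₚ q) x)  ≈⟨ +-cong (eval-map-* a q x) (+-identityˡ _) ⟩
    a * eval q x + x * eval (p *ₚ q) x                  ≈⟨ +-congˡ (*-congˡ (eval-*ₚ p q x)) ⟩
    a * eval q x + x * (eval p x * eval q x)            ≈⟨ +-congˡ (*-assoc x _ _) ⟨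
    a * eval q x + (x * eval p x) * eval q x            ≈⟨ distribʳ (eval q x) a _ ⟨
    (a + x * eval p x) * eval q x                       ∎

  eval-≋0 : ∀ p x → p ≋ [] → eval p x ≈ 0#
  eval-≋0 []      x _   = refl
  eval-≋0 (a ∷ p) x p≋0 =
    trans (+-cong (p≋0 0) (trans (*-congˡ (eval-≋0 p x (λ k → p≋0 (suc k)))) (zeroʳ x))) (+-identityʳ 0#)

  eval-≋ : ∀ p q x → p ≋ q → eval p x ≈ eval q x
  eval-≋ []      q       x p≋q = sym (eval-≋0 q x (λ k → sym (p≋q k)))
  eval-≋ (a ∷ p) []      x p≋q = eval-≋0 (a ∷ p) x p≋q
  eval-≋ (a ∷ p) (b ∷ q) x p≋q = +-cong (p≋q 0) (*-congˡ (eval-≋ p q x (λ k → p≋q (suc k))))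

  eval-cong : ∀ p {x y} → x ≈ y → eval p x ≈ eval p y
  eval-cong []      x≈y = refl
  eval-cong (a ∷ p) x≈y = +-congˡ (*-cong x≈y (eval-cong p x≈y))

  eval-Xpow : ∀ N x → eval (Xpow N) x ≈ pow x N
  eval-Xpow zero    x = trans (+-congˡ (zeroʳ x)) (+-identityʳ 1#)
  eval-Xpow (suc N) x = trans (+-identityˡ _) (*-congˡ (eval-Xpow N x))

  eval-trinom : ∀ N e x → eval (trinom N e) x ≈ pow x N - x - e
  eval-trinom N e x = begin
    eval (trinom N e) x                             ≈⟨ eval-+ₚ (Xpow N) (- e ∷ - 1# ∷ []) x ⟩
    eval (Xpow N) x + (- e + x * (- 1# + x * 0#))   ≈⟨ +-cong (eval-Xpow N x) (+-congˡ (*-congˡ -1+x0≈-1)) ⟩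
    pow x N + (- e + x * - 1#)                      ≈⟨ +-congˡ (+-congˡ x*-1≈-x) ⟩
    pow x N + (- e + - x)                           ≈⟨ +-congˡ (+-comm _ _) ⟩
    pow x N + (- x + - e)                           ≈⟨ +-assoc _ _ _ ⟨
    pow x N - x - e                                 ∎
    where
    -1+x0≈-1 : - 1# + x * 0# ≈ - 1#
    -1+x0≈-1 = trans (+-congˡ (zeroʳ x)) (+-identityʳ (- 1#))
    x*-1≈-x : x * - 1# ≈ - x
    x*-1≈-x = trans (sym (-‿distribʳ-* x 1#)) (-‿cong (*-identityʳ x))

  eval-remainder-at-root : ∀ f g r q x → f ≋ ((q *ₚ g) +ₚ r) → eval g x ≈ 0# → eval f x ≈ eval r x
  eval-remainder-at-root f g r q x f≋qg+r gx≈0 = begin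
    eval f x                      ≈⟨ eval-≋ f ((q *ₚ g) +ₚ r) x f≋qg+r ⟩
    eval ((q *ₚ g) +ₚ r) x        ≈⟨ eval-+ₚ (q *ₚ g) r x ⟩
    eval (q *ₚ g) x + eval r x    ≈⟨ +-congʳ (eval-*ₚ q g x) ⟩
    eval q x * eval g x + eval r x ≈⟨ +-congʳ (trans (*-congˡ gx≈0) (zeroʳ _)) ⟩
    0# + eval r x                 ≈⟨ +-identityˡ _ ⟩
    eval r x                      ∎

  frobenius : Carrier → Carrier
  frobenius x = pow x 2

  ℘ : Carrier → Carrier
  ℘ x = frobenius x - x

  ℘-1≈0 : ℘ 1# ≈ 0#
  ℘-1≈0 = trans (+-congʳ (trans (*-congˡ (*-identityʳ 1#)) (*-identityʳ 1#))) (-‿inverseʳ 1#)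

  ^ᶠ-2^-suc : ∀ (h : Carrier → Carrier) s x → (h ^ᶠ 2 ^ suc s) x ≡ (h ^ᶠ 2 ^ s) ((h ^ᶠ 2 ^ s) x)
  ^ᶠ-2^-suc h s x = ≡.trans (≡.cong (λ n → (h ^ᶠ (2 ^ s ℕ.+ n)) x) (ℕₚ.+-identityʳ (2 ^ s)))
                            (≡.cong-app (^ᶠ-homo h (2 ^ s) (2 ^ s)) x)

  frobenius^ᶠ≈pow : ∀ k x → (frobenius ^ᶠ k) x ≈ pow x (2 ^ k)
  frobenius^ᶠ≈pow zero    x = sym (*-identityʳ x)
  frobenius^ᶠ≈pow (suc k) x = begin
    frobenius y                                 ≈⟨ *-cong y≈x² (*-congʳ y≈x²) ⟩
    pow x (2 ^ k) * (pow x (2 ^ k) * 1#)        ≈⟨ *-congˡ (pow-+ x (2 ^ k) 0) ⟨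
    pow x (2 ^ k) * pow x (2 ^ k ℕ.+ 0)         ≈⟨ pow-+ x (2 ^ k) (2 ^ k ℕ.+ 0) ⟨
    pow x (2 ^ suc k)                           ∎
    where
    y = (frobenius ^ᶠ k) x
    y≈x² = frobenius^ᶠ≈pow k x

  module CharacteristicTwo (1+1≈0 : 1# + 1# ≈ 0#) where

    x+x≈0 : ∀ x → x + x ≈ 0#
    x+x≈0 x = begin
      x + x              ≈⟨ +-cong (*-identityʳ x) (*-identityʳ x) ⟨
      x * 1# + x * 1#    ≈⟨ distribˡ x 1# 1# ⟨
      x * (1# + 1#)      ≈⟨ *-congˡ 1+1≈0 ⟩
      x * 0#             ≈⟨ zeroʳ x ⟩
      0#                 ∎

    -x≈x : ∀ x → - x ≈ x
    -x≈x x = sym (inverseʳ-unique x x (x+x≈0 x))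

    +-cancel-middle : ∀ x y z → (x + y) + (y + z) ≈ x + z
    +-cancel-middle x y z = begin
      (x + y) + (y + z)  ≈⟨ +-assoc x y (y + z) ⟩
      x + (y + (y + z))  ≈⟨ +-congˡ (+-assoc y y z) ⟨
      x + ((y + y) + z)  ≈⟨ +-congˡ (+-congʳ (x+x≈0 y)) ⟩
      x + (0# + z)       ≈⟨ +-congˡ (+-identityˡ z) ⟩
      x + z              ∎

    frobenius-+ : ∀ x y → frobenius (x + y) ≈ frobenius x + frobenius y
    frobenius-+ x y = begin
      (x + y) * ((x + y) * 1#)           ≈⟨ *-congˡ (*-identityʳ (x + y)) ⟩
      (x + y) * (x + y)                  ≈⟨ distribʳ (x + y) x y ⟩
      x * (x + y) + y * (x + y)          ≈⟨ +-cong (distribˡ x x y) (distribˡ y x y) ⟩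
      (x * x + x * y) + (y * x + y * y)  ≈⟨ +-congˡ (+-congʳ (*-comm y x)) ⟩
      (x * x + x * y) + (x * y + y * y)  ≈⟨ +-cancel-middle (x * x) (x * y) (y * y) ⟩
      x * x + y * y                      ≈⟨ +-cong (*-congˡ (*-identityʳ x)) (*-congˡ (*-identityʳ y)) ⟨
      frobenius x + frobenius y          ∎

    frobenius-isAdditive : IsAdditive frobenius
    frobenius-isAdditive = record
      { isMagmaHomomorphism = record
        { isRelHomomorphism = record { cong = λ x≈y → *-cong x≈y (*-congʳ x≈y) }
        ; homo = frobenius-+
        }
      ; ε-homo = zeroˡ _
      }

    ℘-isAdditive : IsAdditive ℘
    ℘-isAdditive = -ᶠ-isAdditive frobenius-isAdditive id-isAdditive

    open IsMonoidHomomorphism ℘-isAdditive using () renaming (⟦⟧-cong to ℘-cong; ε-homo to ℘-0≈0)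

    -- ℘ = frobenius + id, and the cross terms of (frobenius + id)² cancel.
    ℘^2^s≈frobenius^2^s+id : ∀ s x → (℘ ^ᶠ 2 ^ s) x ≈ (frobenius ^ᶠ 2 ^ s) x + x
    ℘^2^s≈frobenius^2^s+id zero    x = +-congˡ (-x≈x x)
    ℘^2^s≈frobenius^2^s+id (suc s) x = begin
      (℘ ^ᶠ 2 ^ suc s) x                      ≡⟨ ^ᶠ-2^-suc ℘ s x ⟩
      ℘ᵏ (℘ᵏ x)                               ≈⟨ ⟦⟧-cong (IH x) ⟩
      ℘ᵏ (Fᵏ x + x)                           ≈⟨ homo (Fᵏ x) x ⟩
      ℘ᵏ (Fᵏ x) + ℘ᵏ x                        ≈⟨ +-cong (IH (Fᵏ x)) (IH x) ⟩
      (Fᵏ (Fᵏ x) + Fᵏ x) + (Fᵏ x + x)         ≈⟨ +-cancel-middle _ _ _ ⟩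
      Fᵏ (Fᵏ x) + x                           ≡⟨ ≡.cong (_+ x) (^ᶠ-2^-suc frobenius s x) ⟨
      (frobenius ^ᶠ 2 ^ suc s) x + x          ∎
      where
      ℘ᵏ = ℘ ^ᶠ 2 ^ s
      Fᵏ = frobenius ^ᶠ 2 ^ s
      IH = ℘^2^s≈frobenius^2^s+id s
      open IsMonoidHomomorphism (^ᶠ-isAdditive ℘-isAdditive (2 ^ s))

    ℘^2^s≈pow : ∀ s x → (℘ ^ᶠ 2 ^ s) x ≈ pow x (2 ^ 2 ^ s) - x
    ℘^2^s≈pow s x = trans (℘^2^s≈frobenius^2^s+id s x) (+-cong (frobenius^ᶠ≈pow (2 ^ s) x) (sym (-x≈x x)))

    module CantorBasis (L : ℕ) (β : ℕ → Carrier) (β0≈1 : β 0 ≈ 1#)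
                       (℘β : ∀ t → suc t < 2 ^ L → ℘ (β (suc t)) ≈ β t) where

      n = 2 ^ L
      ϖ = varpi L β

      ℘^k-β-+ : ∀ k t → t ℕ.+ k < n → (℘ ^ᶠ k) (β (t ℕ.+ k)) ≈ β t
      ℘^k-β-+ zero    t _ = reflexive (≡.cong β (ℕₚ.+-identityʳ t))
      ℘^k-β-+ (suc k) t t+1+k<n = begin
        ℘ ((℘ ^ᶠ k) (β (t ℕ.+ suc k)))   ≡⟨ ≡.cong (λ u → ℘ ((℘ ^ᶠ k) (β u))) (ℕₚ.+-suc t k) ⟩
        ℘ ((℘ ^ᶠ k) (β (suc t ℕ.+ k)))   ≈⟨ ℘-cong (℘^k-β-+ k (suc t) 1+t+k<n) ⟩
        ℘ (β (suc t))                    ≈⟨ ℘β t (ℕₚ.≤-trans (s≤s (ℕₚ.m≤m+n (suc t) k)) 1+t+k<n) ⟩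
        β t                              ∎
        where
        1+t+k<n = ≡.subst (_< n) (ℕₚ.+-suc t k) t+1+k<n

      ℘^k-β-< : ∀ k t → t < k → t < n → (℘ ^ᶠ k) (β t) ≈ 0#
      ℘^k-β-< (suc k) t (s≤s t≤k) t<n with ℕₚ.m≤n⇒m<n∨m≡n t≤k
      ... | inj₁ t<k    = trans (℘-cong (℘^k-β-< k t t<k t<n)) ℘-0≈0
      ... | inj₂ ≡.refl = trans (℘-cong (trans (℘^k-β-+ t 0 t<n) β0≈1)) ℘-1≈0

      varpi-split : ∀ k i j → i < 2 ^ k → ϖ (i ℕ.+ j ℕ.* 2 ^ k) ≈ ϖ i + ϖ (j ℕ.* 2 ^ k)
      varpi-split k i j i<2^k = trans (Σ<-cong n (λ t _ → digit t)) (Σ<-distrib-+ n _ _)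
        where
        digit : ∀ t → testBit t (i ℕ.+ j ℕ.* 2 ^ k) · β t ≈ testBit t i · β t + testBit t (j ℕ.* 2 ^ k) · β t
        digit t = trans (reflexive (≡.cong (_· β t) (testBit-+-*2^ j k t i<2^k)))
                        (∨-·-distrib (testBit t i) (testBit t (j ℕ.* 2 ^ k)) (β t) (testBit-∧-*2^ j k t i<2^k))

      ℘^k-varpi-< : ∀ k i → k ≤ n → i < 2 ^ k → (℘ ^ᶠ k) (ϖ i) ≈ 0#
      ℘^k-varpi-< k i k≤n i<2^k = trans (additive-Σ< ℘ᵏ-additive n _) (Σ<-zero n digit)
        where
        ℘ᵏ-additive = ^ᶠ-isAdditive ℘-isAdditive k
        digit : ∀ t → t < n → (℘ ^ᶠ k) (testBit t i · β t) ≈ 0#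
        digit t t<n with t <? k
        ... | yes t<k = trans (additive-· ℘ᵏ-additive (testBit t i) (β t))
                              (trans (·-cong (testBit t i) (℘^k-β-< k t t<k t<n)) (·-zeroʳ (testBit t i)))
        ... | no t≮k  = trans (additive-· ℘ᵏ-additive (testBit t i) (β t))
                              (reflexive (≡.cong (_· _) (testBit-high k t i<2^k (ℕₚ.≮⇒≥ t≮k))))

      ℘^k-varpi-*2^ : ∀ k j → k ≤ n → j < 2 ^ (n ∸ k) → (℘ ^ᶠ k) (ϖ (j ℕ.* 2 ^ k)) ≈ ϖ j
      ℘^k-varpi-*2^ k j k≤n j<2^d = begin
        (℘ ^ᶠ k) (ϖ (j ℕ.* 2 ^ k))   ≈⟨ additive-Σ< ℘ᵏ-additive n _ ⟩
        Σ< n (λ t → (℘ ^ᶠ k) (testBit t (j ℕ.* 2 ^ k) · β t))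
                                      ≈⟨ Σ<-cong n (λ t _ → additive-· ℘ᵏ-additive (testBit t (j ℕ.* 2 ^ k)) (β t)) ⟩
        Σ< n F                        ≡⟨ ≡.cong (λ m → Σ< m F) (ℕₚ.m+[n∸m]≡n k≤n) ⟨
        Σ< (k ℕ.+ d) F                ≈⟨ Σ<-drop-zero-prefix k d F low-digit ⟩
        Σ< d (λ u → F (k ℕ.+ u))      ≈⟨ Σ<-cong d shifted-digit ⟩
        Σ< d G                        ≈⟨ Σ<-drop-zero-suffix d k G high-digit ⟨
        Σ< (d ℕ.+ k) G                ≡⟨ ≡.cong (λ m → Σ< m G) (ℕₚ.m∸n+n≡m k≤n) ⟩
        ϖ j                           ∎
        where
        ℘ᵏ-additive = ^ᶠ-isAdditive ℘-isAdditive k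
        d = n ∸ k
        F G : ℕ → Carrier
        F t = testBit t (j ℕ.* 2 ^ k) · (℘ ^ᶠ k) (β t)
        G u = testBit u j · β u
        low-digit : ∀ t → t < k → F t ≈ 0#
        low-digit t t<k = reflexive (≡.cong (_· _) (testBit-*2^ j k t t<k))
        shifted-digit : ∀ u → u < d → F (k ℕ.+ u) ≈ G u
        shifted-digit u u<d = trans (reflexive (≡.cong (_· _) (testBit-shift j k u (ℕₚ.m^n>0 2 k))))
          (·-cong (testBit u j) (trans (reflexive (≡.cong (λ v → (℘ ^ᶠ k) (β v)) (ℕₚ.+-comm k u)))
                                       (℘^k-β-+ k u (≡.subst (u ℕ.+ k <_) (ℕₚ.m∸n+n≡m k≤n) (ℕₚ.+-monoˡ-< k u<d)))))
        high-digit : ∀ v → v < k → G (d ℕ.+ v) ≈ 0#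
        high-digit v _ = reflexive (≡.cong (_· _) (testBit-high d (d ℕ.+ v) j<2^d (ℕₚ.m≤m+n d v)))

      ℘^k-translate : ∀ k a i j → k ≤ n → i < 2 ^ k → j < 2 ^ (n ∸ k) →
                      (℘ ^ᶠ k) (a + ϖ (i ℕ.+ j ℕ.* 2 ^ k)) ≈ (℘ ^ᶠ k) a + ϖ j
      ℘^k-translate k a i j k≤n i<2^k j<2^d = begin
        ℘ᵏ (a + ϖ (i ℕ.+ j ℕ.* 2 ^ k))          ≈⟨ homo a _ ⟩
        ℘ᵏ a + ℘ᵏ (ϖ (i ℕ.+ j ℕ.* 2 ^ k))       ≈⟨ +-congˡ (⟦⟧-cong (varpi-split k i j i<2^k)) ⟩
        ℘ᵏ a + ℘ᵏ (ϖ i + ϖ (j ℕ.* 2 ^ k))       ≈⟨ +-congˡ (homo (ϖ i) _) ⟩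
        ℘ᵏ a + (℘ᵏ (ϖ i) + ℘ᵏ (ϖ (j ℕ.* 2 ^ k))) ≈⟨ +-congˡ (+-cong (℘^k-varpi-< k i k≤n i<2^k) (℘^k-varpi-*2^ k j k≤n j<2^d)) ⟩
        ℘ᵏ a + (0# + ϖ j)                       ≈⟨ +-congˡ (+-identityˡ (ϖ j)) ⟩
        ℘ᵏ a + ϖ j                              ∎
        where
        ℘ᵏ = ℘ ^ᶠ k
        open IsMonoidHomomorphism (^ᶠ-isAdditive ℘-isAdditive k)

      trinom-root : ∀ s a i j → 2 ^ s ≤ n → i < 2 ^ 2 ^ s → j < 2 ^ (n ∸ 2 ^ s) →
                    let N = 2 ^ 2 ^ s in
                    eval (trinom N ((pow a N - a) + ϖ j)) (a + ϖ (i ℕ.+ j ℕ.* N)) ≈ 0#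
      trinom-root s a i j 2^s≤n i<N j<2^d = begin
        eval (trinom N e) x     ≈⟨ eval-trinom N e x ⟩
        pow x N - x - e         ≈⟨ +-congʳ (℘^2^s≈pow s x) ⟨
        (℘ ^ᶠ 2 ^ s) x - e      ≈⟨ +-congʳ (℘^k-translate (2 ^ s) a i j 2^s≤n i<N j<2^d) ⟩
        (℘ ^ᶠ 2 ^ s) a + ϖ j - e ≈⟨ +-congʳ (+-congʳ (℘^2^s≈pow s a)) ⟩
        e - e                   ≈⟨ -‿inverseʳ e ⟩
        0#                      ∎
        where
        N = 2 ^ 2 ^ s
        e = (pow a N - a) + ϖ j
        x = a + ϖ (i ℕ.+ j ℕ.* N)

      +-varpi-split : ∀ k a i j → i < 2 ^ k → a + ϖ (i ℕ.+ j ℕ.* 2 ^ k) ≈ (a + ϖ (j ℕ.* 2 ^ k)) + ϖ i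
      +-varpi-split k a i j i<2^k = begin
        a + ϖ (i ℕ.+ j ℕ.* 2 ^ k)      ≈⟨ +-congˡ (varpi-split k i j i<2^k) ⟩
        a + (ϖ i + ϖ (j ℕ.* 2 ^ k))    ≈⟨ +-congˡ (+-comm (ϖ i) _) ⟩
        a + (ϖ (j ℕ.* 2 ^ k) + ϖ i)    ≈⟨ +-assoc a _ (ϖ i) ⟨
        (a + ϖ (j ℕ.* 2 ^ k)) + ϖ i    ∎

lemma2p2 : ∀ {c ℓ : Level} (R : CommutativeRing c ℓ) →
  let open CommutativeRing R
      open Field R
  in (L m : ℕ) → 1 < m → m ≤ 2 ^ L →
     IsField → (1# + 1#) ≈ 0# →
     (β : ℕ → Carrier) → IsCantorBasis L β →
     (a : Carrier) → ¬ InW β m a →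
     (f : Poly) → DegLt f (2 ^ m) →
     (i j : ℕ) → i < 2 ^ (2 ^ (⌈log₂ m ⌉ ∸ 1)) →
     j < 2 ^ (m ∸ 2 ^ (⌈log₂ m ⌉ ∸ 1)) →
     (r : Poly) →
     IsRemainder f
       (trinom (2 ^ (2 ^ (⌈log₂ m ⌉ ∸ 1)))
               ((pow a (2 ^ (2 ^ (⌈log₂ m ⌉ ∸ 1))) - a) + varpi L β j))
       (2 ^ (2 ^ (⌈log₂ m ⌉ ∸ 1))) r →
     eval f (a + varpi L β (i ℕ.+ j ℕ.* 2 ^ (2 ^ (⌈log₂ m ⌉ ∸ 1))))
       ≈ eval r ((a + varpi L β (j ℕ.* 2 ^ (2 ^ (⌈log₂ m ⌉ ∸ 1)))) + varpi L β i)
lemma2p2 R L m _ m≤2^L _ 1+1≈0 β (_ , β0≈1 , ℘β) a _ f _ i j i<N j<2^[m∸k] r (_ , q , f≋qg+r) = begin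
  eval f x                         ≈⟨ eval-remainder-at-root R f _ r q x f≋qg+r (trinom-root s a i j k≤n i<N j<2^[n∸k]) ⟩
  eval r x                         ≈⟨ eval-cong R r (+-varpi-split k a i j i<N) ⟩
  eval r ((a + ϖ (j ℕ.* N)) + ϖ i) ∎
  where
  open CommutativeRing R
  open Field R
  open CharacteristicTwo R 1+1≈0
  open CantorBasis L β β0≈1 ℘β
  open import Relation.Binary.Reasoning.Setoid setoid
  s = ⌈log₂ m ⌉ ∸ 1
  k = 2 ^ s
  N = 2 ^ k
  x = a + ϖ (i ℕ.+ j ℕ.* N)
  k≤n : k ≤ n
  k≤n = ℕₚ.^-monoʳ-≤ 2 (ℕₚ.≤-trans (ℕₚ.m∸n≤m ⌈log₂ m ⌉ 1)
          (≡.subst (⌈log₂ m ⌉ ≤_) (⌈log₂2^n⌉≡n L) (⌈log₂⌉-mono-≤ m≤2^L)))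
  j<2^[n∸k] : j < 2 ^ (n ∸ k)
  j<2^[n∸k] = ℕₚ.<-≤-trans j<2^[m∸k] (ℕₚ.^-monoʳ-≤ 2 (ℕₚ.∸-monoˡ-≤ k m≤2^L))
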